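{- Let $r\ge 2$, let $x_1,\dots,x_r\in\mathbb{C}$, and let $\ell_0,\dots,\ell_{r-1}\in\mathbb{C}$ (the values at $(x_1,\dots,x_r)$ of arbitrary polynomials in $\mathbb{Q}[x_1,\dots,x_r]$). Define $\mathcal{F}^{[r]}_n=\ell_n$ for $0\le n\le r-1$ and $\mathcal{F}^{[r]}_n=\sum_{i=1}^r x_i\mathcal{F}^{[r]}_{n-i}$ for $n\ge r$. Suppose the polynomial $z^r-x_1z^{r-1}-\cdots-x_{r-1}z-x_r$ has $r$ distinct roots $\lambda_1,\dots,\lambda_r$. For $1\le i\le r$ define $$\sigma_{i,1}=\Big(\prod_{\substack{1\le m\le r\\ m\ne i}}(\lambda_i-\lambda_m)\Big)^{ -1},\qquad \sigma_{i,j}=(-1)^{r-j}\,\frac{\displaystyle\sum_{\substack{1\le m_1<\cdots<m_{j-1}\le r\\ m_1,\dots,m_{j-1}\ne i}}\lambda_{m_1}\cdots\lambda_{m_{j-1}}}{\displaystyle\prod_{\substack{1\le m\le r\\ m\ne i}}(\lambda_m-\lambda_i)}\quad(1<j\le r).$$ Then for every integer $n\ge 0$ (with the convention $0^0=1$), $$\mathcal{F}^{[r]}_n=\sum_{i=1}^r\Big(\lambda_i^{\,n}\sum_{j=1}^r\sigma_{i,j}\,\ell_{r-j}\Big).$$ -}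

module Defs where

open import Level using (Level; _⊔_) renaming (suc to lsuc)
open import Data.Nat using (ℕ; zero; suc; _∸_; _≤_)
open import Data.Fin using (Fin; toℕ; opposite)
open import Data.Fin.Properties using (_≟_)
open import Data.List using (List; []; _∷_; filter)
open import Data.List.Base using (allFin)
open import Relation.Nullary using (¬_; yes; no)
open import Relation.Nullary using (¬?)
open import Relation.Binary.PropositionalEquality using (_≡_; _≢_)
open import Algebra.Bundles using (CommutativeRing)

-- A field: a commutative ring with 0 ≠ 1 and a (total) inverse operation
-- that is a multiplicative inverse on every nonzero element
-- (the value of 0⁻¹ is irrelevant; it never occurs in the statement since
-- the denominators are nonzero by the distinct-roots hypothesis).
record Field (c ℓ : Level) : Set (lsuc (c ⊔ ℓ)) where
  field
    commutativeRing : CommutativeRing c ℓ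
  open CommutativeRing commutativeRing public
  field
    _⁻¹       : Carrier → Carrier
    ⁻¹-inverse : ∀ x → ¬ (x ≈ 0#) → x * (x ⁻¹) ≈ 1#
    0≉1       : ¬ (0# ≈ 1#)

module FieldOps {c ℓ : Level} (K : Field c ℓ) where
  open Field K

  pow : Carrier → ℕ → Carrier
  pow x zero    = 1#
  pow x (suc n) = x * pow x n

  sumFin : (n : ℕ) → (Fin n → Carrier) → Carrier
  sumFin zero    f = 0#
  sumFin (suc n) f = f Fin.zero + sumFin n (λ i → f (Fin.suc i))

  prodFin : (n : ℕ) → (Fin n → Carrier) → Carrier
  prodFin zero    f = 1#
  prodFin (suc n) f = f Fin.zero * prodFin n (λ i → f (Fin.suc i))

  prodExcept : (n : ℕ) → Fin n → (Fin n → Carrier) → Carrier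
  prodExcept n i f = prodFin n (λ m → g m)
    where
      g : Fin n → Carrier
      g m with m ≟ i
      ... | yes _ = 1#
      ... | no  _ = f m

  -- elementary symmetric sum e_k of a list of values:
  -- e_k [a_1,…,a_s] = Σ_{1 ≤ m_1 < ⋯ < m_k ≤ s} a_{m_1} ⋯ a_{m_k}
  esym : ℕ → List Carrier → Carrier
  esym zero    _        = 1#
  esym (suc k) []       = 0#
  esym (suc k) (a ∷ as) = a * esym k as + esym (suc k) as

  mapL : {A : Set} → (A → Carrier) → List A → List Carrier
  mapL f []       = []
  mapL f (a ∷ as) = f a ∷ mapL f as

  others : (r : ℕ) → Fin r → List (Fin r)
  others r i = filter (λ m → ¬? (m ≟ i)) (allFin r)

  -- σ_{i,j} (indices 0-based: i ↦ i+1, j ↦ j+1 in the paper)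
  σ : (r : ℕ) → (Fin r → Carrier) → Fin r → Fin r → Carrier
  σ r lam i Fin.zero    = (prodExcept r i (λ m → lam i - lam m)) ⁻¹
  σ r lam i (Fin.suc j) =
    pow (- 1#) (r ∸ suc (suc (toℕ j)))
      * (esym (suc (toℕ j)) (mapL lam (others r i))
          * (prodExcept r i (λ m → lam m - lam i)) ⁻¹)

-- Put c_i = ∑_j σ_{i,j} ℓ_{r-j}.  Since every λ_i is a root of the characteristic polynomial,
-- n ↦ ∑_i c_i λ_i^n satisfies the recurrence of F, so it suffices that both agree for n < r.
-- By Vieta's formulas the σ_{i,j} are the coefficients of the Lagrange basis polynomials
-- L_i(z) = ∏_{m ≠ i} (z - λ_m) / (λ_i - λ_m), i.e. L_i(λ_j) = δ_ij: they form a left inverse of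
-- the Vandermonde matrix (λ_i^k).  A polynomial of degree < r with r distinct roots vanishes, so
-- it is also a right inverse, and this is exactly the agreement ∑_i c_i λ_i^k = ℓ_k for k < r.

module Submission where

open import Defs
open import Level using (Level)
open import Algebra.Bundles using (CommutativeRing)
open import Data.Nat using (ℕ; zero; suc; _∸_; _≤_; _<_; s≤s; z≤n)
open import Data.Nat.Properties
  using (n<1+n; m<n⇒m<1+n; ≮⇒≥; ∸-monoʳ-<; ≤-trans; +-∸-assoc; m∸n+n≡m; _<?_)
open import Data.Nat.Induction using (<-rec)
open import Data.Fin using (Fin; toℕ; fromℕ<; opposite)
import Data.Fin as Fin
open import Data.Fin.Properties
  using (_≟_; toℕ<n; toℕ-fromℕ<; punchInᵢ≢i; suc-injective; opposite-involutive; opposite-prop)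
import Data.Fin.Permutation as Perm
open import Data.Vec.Functional using (removeAt; head; tail)
open import Data.List using (List; []; _∷_; foldr; filter; tabulate; allFin; length)
open import Data.Product using (Σ; _,_; proj₁)
open import Data.Maybe using (nothing)
open import Function using (_∘_; id)
open import Relation.Nullary using (¬_; ¬?; yes; no; contradiction)
open import Relation.Binary.PropositionalEquality as ≡ using (_≡_; _≢_)
open import Tactic.RingSolver.Core.AlmostCommutativeRing using (AlmostCommutativeRing; fromCommutativeRing)

module Sums {c ℓ : Level} (R : CommutativeRing c ℓ) where
  open CommutativeRing R
  open import Algebra.Properties.Semiring.Sum semiring
  open import Relation.Binary.Reasoning.Setoid setoid

  ∑-reverse : ∀ {n} (f : Fin n → Carrier) → ∑[ i < n ] f i ≈ ∑[ i < n ] f (opposite i)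
  ∑-reverse f = ∑-permute f Perm.reverse

  ∑-single : ∀ {n} (f : Fin n → Carrier) j → (∀ i → i ≢ j → f i ≈ 0#) → ∑[ i < n ] f i ≈ f j
  ∑-single {suc n} f j others≈0 = begin
    sum f                         ≈⟨ sum-remove f ⟩
    f j + sum (removeAt f j)      ≈⟨ +-congˡ (sum-cong-≋ {n} (λ k → others≈0 _ (punchInᵢ≢i j k))) ⟩
    f j + sum {n} (λ _ → 0#)      ≈⟨ +-congˡ (sum-replicate-zero n) ⟩
    f j + 0#                      ≈⟨ +-identityʳ (f j) ⟩
    f j                           ∎

  ∑∑-assoc : ∀ {k n} (a : Fin k → Carrier) (C : Fin k → Fin n → Carrier) (b : Fin n → Carrier) →
             ∑[ m < n ] (∑[ i < k ] (a i * C i m) * b m) ≈ ∑[ i < k ] (a i * ∑[ m < n ] (C i m * b m))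
  ∑∑-assoc {k} {n} a C b = begin
    ∑[ m < n ] (∑[ i < k ] (a i * C i m) * b m)
      ≈⟨ sum-cong-≋ {n} (λ m → *-distribʳ-sum (b m) (λ i → a i * C i m)) ⟩
    ∑[ m < n ] ∑[ i < k ] (a i * C i m * b m)
      ≈⟨ ∑-comm {n} {k} (λ m i → a i * C i m * b m) ⟩
    ∑[ i < k ] ∑[ m < n ] (a i * C i m * b m)
      ≈⟨ sum-cong-≋ {k} (λ i → sum-cong-≋ {n} (λ m → *-assoc (a i) (C i m) (b m))) ⟩
    ∑[ i < k ] ∑[ m < n ] (a i * (C i m * b m))
      ≈⟨ sum-cong-≋ {k} (λ i → *-distribˡ-sum (a i) (λ m → C i m * b m)) ⟨
    ∑[ i < k ] (a i * ∑[ m < n ] (C i m * b m)) ∎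

  δ : ∀ {n} → Fin n → Fin n → Carrier
  δ i j with i ≟ j
  ... | yes _ = 1#
  ... | no  _ = 0#

  δ-refl : ∀ {n} (i : Fin n) → δ i i ≈ 1#
  δ-refl i with i ≟ i
  ... | yes _   = refl
  ... | no  i≢i = contradiction ≡.refl i≢i

  δ-≢ : ∀ {n} {i j : Fin n} → i ≢ j → δ i j ≈ 0#
  δ-≢ {i = i} {j} i≢j with i ≟ j
  ... | yes i≡j = contradiction i≡j i≢j
  ... | no  _   = refl

  ∑-δ : ∀ {n} (f : Fin n → Carrier) j → ∑[ i < n ] (δ i j * f i) ≈ f j
  ∑-δ {n} f j = begin
    ∑[ i < n ] (δ i j * f i)
      ≈⟨ ∑-single (λ i → δ i j * f i) j (λ i i≢j → trans (*-congʳ (δ-≢ i≢j)) (zeroˡ (f i))) ⟩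
    δ j j * f j
      ≈⟨ *-congʳ (δ-refl j) ⟩
    1# * f j
      ≈⟨ *-identityˡ (f j) ⟩
    f j ∎

module LinearRecurrences {c ℓ : Level} (R : CommutativeRing c ℓ) where
  open CommutativeRing R
  open Sums R using (∑∑-assoc)
  open import Algebra.Properties.Semiring.Sum semiring
  open import Algebra.Properties.CommutativeSemiring.Exp commutativeSemiring
  open import Algebra.Properties.CommutativeSemigroup *-commutativeSemigroup
    using () renaming (x∙yz≈y∙xz to x*yz≈y*xz)
  open import Relation.Binary.Reasoning.Setoid setoid

  SolvesRecurrence : ∀ {r} → (Fin r → Carrier) → (ℕ → Carrier) → Set ℓ
  SolvesRecurrence {r} x F = ∀ n → r ≤ n → F n ≈ ∑[ k < r ] (x k * F (n ∸ suc (toℕ k)))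

  recurrence-unique : ∀ {r} (x : Fin r → Carrier) {F G : ℕ → Carrier} →
                      SolvesRecurrence x F → SolvesRecurrence x G →
                      (∀ (k : Fin r) → F (toℕ k) ≈ G (toℕ k)) → ∀ n → F n ≈ G n
  recurrence-unique {r} x {F} {G} F-rec G-rec F≈G-initially = <-rec _ step
    where
    step : ∀ n → (∀ {m} → m < n → F m ≈ G m) → F n ≈ G n
    step n earlier with n <? r
    ... | yes n<r = ≡.subst (λ m → F m ≈ G m) (toℕ-fromℕ< n<r) (F≈G-initially (fromℕ< n<r))
    ... | no n≮r = begin
      F n
        ≈⟨ F-rec n r≤n ⟩
      ∑[ k < r ] (x k * F (n ∸ suc (toℕ k)))
        ≈⟨ sum-cong-≋ {r} (λ k → *-congˡ (earlier (lag<n k))) ⟩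
      ∑[ k < r ] (x k * G (n ∸ suc (toℕ k)))
        ≈⟨ G-rec n r≤n ⟨
      G n ∎
      where
      r≤n : r ≤ n
      r≤n = ≮⇒≥ n≮r
      lag<n : ∀ (k : Fin r) → n ∸ suc (toℕ k) < n
      lag<n k = ∸-monoʳ-< (s≤s z≤n) (≤-trans (toℕ<n k) r≤n)

  root-powers-solve : ∀ {r} (x : Fin r → Carrier) z →
                      z ^ r ≈ ∑[ k < r ] (x k * z ^ (r ∸ suc (toℕ k))) → SolvesRecurrence x (z ^_)
  root-powers-solve {r} x z root n r≤n = begin
    z ^ n
      ≡⟨ ≡.cong (z ^_) (m∸n+n≡m r≤n) ⟨
    z ^ (n ∸ r ℕ+ r)
      ≈⟨ ^-homo-* z (n ∸ r) r ⟩
    z ^ (n ∸ r) * z ^ r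
      ≈⟨ *-congˡ root ⟩
    z ^ (n ∸ r) * ∑[ k < r ] (x k * z ^ (r ∸ suc (toℕ k)))
      ≈⟨ *-distribˡ-sum (z ^ (n ∸ r)) (λ k → x k * z ^ (r ∸ suc (toℕ k))) ⟩
    ∑[ k < r ] (z ^ (n ∸ r) * (x k * z ^ (r ∸ suc (toℕ k))))
      ≈⟨ sum-cong-≋ {r} shift ⟩
    ∑[ k < r ] (x k * z ^ (n ∸ suc (toℕ k))) ∎
    where
    open Data.Nat using () renaming (_+_ to _ℕ+_)
    shift : ∀ (k : Fin r) → z ^ (n ∸ r) * (x k * z ^ (r ∸ suc (toℕ k))) ≈ x k * z ^ (n ∸ suc (toℕ k))
    shift k = begin
      z ^ (n ∸ r) * (x k * z ^ (r ∸ suc (toℕ k)))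
        ≈⟨ x*yz≈y*xz (z ^ (n ∸ r)) (x k) _ ⟩
      x k * (z ^ (n ∸ r) * z ^ (r ∸ suc (toℕ k)))
        ≈⟨ *-congˡ (^-homo-* z (n ∸ r) (r ∸ suc (toℕ k))) ⟨
      x k * z ^ (n ∸ r ℕ+ (r ∸ suc (toℕ k)))
        ≡⟨ ≡.cong (λ e → x k * z ^ e) exponent ⟩
      x k * z ^ (n ∸ suc (toℕ k)) ∎
      where
      exponent : n ∸ r ℕ+ (r ∸ suc (toℕ k)) ≡ n ∸ suc (toℕ k)
      exponent = ≡.trans (≡.sym (+-∸-assoc (n ∸ r) (toℕ<n k))) (≡.cong (_∸ suc (toℕ k)) (m∸n+n≡m r≤n))

  combination-solves : ∀ {r m} (x : Fin r → Carrier) (u : Fin m → ℕ → Carrier) (a : Fin m → Carrier) →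
                       (∀ i → SolvesRecurrence x (u i)) →
                       SolvesRecurrence x (λ n → ∑[ i < m ] (u i n * a i))
  combination-solves {r} {m} x u a u-rec n r≤n = begin
    ∑[ i < m ] (u i n * a i)
      ≈⟨ sum-cong-≋ {m} (λ i → *-congʳ (u-rec i n r≤n)) ⟩
    ∑[ i < m ] (∑[ k < r ] (x k * u i (n ∸ suc (toℕ k))) * a i)
      ≈⟨ ∑∑-assoc x (λ k i → u i (n ∸ suc (toℕ k))) a ⟩
    ∑[ k < r ] (x k * ∑[ i < m ] (u i (n ∸ suc (toℕ k)) * a i)) ∎

module FieldProperties {c ℓ : Level} (K : Field c ℓ) where
  open Field K
  open import Algebra.Properties.CommutativeSemiring.Exp commutativeSemiring
  open import Algebra.Properties.Ring ring using (-1*x≈-x)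
  open import Algebra.Properties.Group +-group using (x∙y⁻¹≈ε⇒x≈y; ⁻¹-involutive)
  open import Algebra.Properties.CommutativeSemigroup *-commutativeSemigroup
    using () renaming (interchange to *-interchange; x∙yz≈y∙xz to x*yz≈y*xz)
  open import Relation.Binary.Reasoning.Setoid setoid

  x-y≈0⇒x≈y : ∀ {x y} → x - y ≈ 0# → x ≈ y
  x-y≈0⇒x≈y = x∙y⁻¹≈ε⇒x≈y _ _

  1≉0 : ¬ 1# ≈ 0#
  1≉0 1≈0 = 0≉1 (sym 1≈0)

  ⁻¹-inverseˡ : ∀ x → ¬ x ≈ 0# → x ⁻¹ * x ≈ 1#
  ⁻¹-inverseˡ x x≉0 = trans (*-comm (x ⁻¹) x) (⁻¹-inverse x x≉0)

  *-cancelˡ-≉0 : ∀ {x y z} → ¬ x ≈ 0# → x * y ≈ x * z → y ≈ z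
  *-cancelˡ-≉0 {x} {y} {z} x≉0 xy≈xz = begin
    y                ≈⟨ *-identityˡ y ⟨
    1# * y           ≈⟨ *-congʳ (⁻¹-inverseˡ x x≉0) ⟨
    (x ⁻¹ * x) * y   ≈⟨ *-assoc (x ⁻¹) x y ⟩
    x ⁻¹ * (x * y)   ≈⟨ *-congˡ xy≈xz ⟩
    x ⁻¹ * (x * z)   ≈⟨ *-assoc (x ⁻¹) x z ⟨
    (x ⁻¹ * x) * z   ≈⟨ *-congʳ (⁻¹-inverseˡ x x≉0) ⟩
    1# * z           ≈⟨ *-identityˡ z ⟩
    z                ∎

  x*y≈0⇒y≈0 : ∀ {x y} → ¬ x ≈ 0# → x * y ≈ 0# → y ≈ 0#
  x*y≈0⇒y≈0 {x} x≉0 xy≈0 = *-cancelˡ-≉0 x≉0 (trans xy≈0 (sym (zeroʳ x)))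

  *-≉0 : ∀ {x y} → ¬ x ≈ 0# → ¬ y ≈ 0# → ¬ x * y ≈ 0#
  *-≉0 x≉0 y≉0 xy≈0 = y≉0 (x*y≈0⇒y≈0 x≉0 xy≈0)

  x*[y*x⁻¹]≈y : ∀ {x} y → ¬ x ≈ 0# → x * (y * x ⁻¹) ≈ y
  x*[y*x⁻¹]≈y {x} y x≉0 = begin
    x * (y * x ⁻¹)   ≈⟨ x*yz≈y*xz x y (x ⁻¹) ⟩
    y * (x * x ⁻¹)   ≈⟨ *-congˡ (⁻¹-inverse x x≉0) ⟩
    y * 1#           ≈⟨ *-identityʳ y ⟩
    y                ∎

  ⁻¹-unique : ∀ {x y} → y * x ≈ 1# → y ≈ x ⁻¹
  ⁻¹-unique {x} {y} yx≈1 = *-cancelˡ-≉0 x≉0 (trans (*-comm x y) (trans yx≈1 (sym (⁻¹-inverse x x≉0))))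
    where
    x≉0 : ¬ x ≈ 0#
    x≉0 x≈0 = 1≉0 (trans (sym yx≈1) (trans (*-congˡ x≈0) (zeroʳ y)))

  1^n≈1 : ∀ n → 1# ^ n ≈ 1#
  1^n≈1 zero    = refl
  1^n≈1 (suc n) = trans (*-identityˡ (1# ^ n)) (1^n≈1 n)

  [-1]^n*[-1]^n≈1 : ∀ n → (- 1#) ^ n * (- 1#) ^ n ≈ 1#
  [-1]^n*[-1]^n≈1 n = begin
    (- 1#) ^ n * (- 1#) ^ n  ≈⟨ ^-distrib-* (- 1#) (- 1#) n ⟨
    (- 1# * - 1#) ^ n        ≈⟨ ^-congˡ n (trans (-1*x≈-x (- 1#)) (⁻¹-involutive 1#)) ⟩
    1# ^ n                   ≈⟨ 1^n≈1 n ⟩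
    1#                       ∎

  [-x]^n≈[-1]^n*x^n : ∀ x n → (- x) ^ n ≈ (- 1#) ^ n * x ^ n
  [-x]^n≈[-1]^n*x^n x n = trans (^-congˡ n (sym (-1*x≈-x x))) (^-distrib-* (- 1#) x n)

  ⁻¹-sign : ∀ n {x y} → ¬ y ≈ 0# → x ≈ (- 1#) ^ n * y → x ⁻¹ ≈ (- 1#) ^ n * y ⁻¹
  ⁻¹-sign n {x} {y} y≉0 x≈±y = sym (⁻¹-unique (begin
    (ε * y ⁻¹) * x          ≈⟨ *-congˡ x≈±y ⟩
    (ε * y ⁻¹) * (ε * y)    ≈⟨ *-interchange ε (y ⁻¹) ε y ⟩
    (ε * ε) * (y ⁻¹ * y)    ≈⟨ *-cong ([-1]^n*[-1]^n≈1 n) (⁻¹-inverseˡ y y≉0) ⟩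
    1# * 1#                 ≈⟨ *-identityˡ 1# ⟩
    1#                      ∎))
    where ε = (- 1#) ^ n

module Products {c ℓ : Level} (K : Field c ℓ) where
  open Field K
  open FieldOps K
  open FieldProperties K using (1≉0; *-≉0)
  open import Algebra.Properties.CommutativeSemiring.Exp commutativeSemiring
  open import Algebra.Properties.Ring ring using (-1*x≈-x)
  open import Algebra.Properties.AbelianGroup +-abelianGroup using (⁻¹-anti-homo‿-)
  open import Algebra.Properties.CommutativeSemigroup *-commutativeSemigroup
    using () renaming (interchange to *-interchange)
  open import Relation.Binary.Reasoning.Setoid setoid

  prodFin-≉0 : ∀ n (g : Fin n → Carrier) → (∀ m → ¬ g m ≈ 0#) → ¬ prodFin n g ≈ 0#
  prodFin-≉0 zero    g g≉0 = 1≉0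
  prodFin-≉0 (suc n) g g≉0 = *-≉0 (g≉0 Fin.zero) (prodFin-≉0 n (g ∘ Fin.suc) (g≉0 ∘ Fin.suc))

  prodFin-≈0 : ∀ n (g : Fin n → Carrier) m → g m ≈ 0# → prodFin n g ≈ 0#
  prodFin-≈0 (suc n) g Fin.zero    g0≈0 = trans (*-congʳ g0≈0) (zeroˡ _)
  prodFin-≈0 (suc n) g (Fin.suc m) gm≈0 = trans (*-congˡ (prodFin-≈0 n (g ∘ Fin.suc) m gm≈0)) (zeroʳ _)

  -- The factors of prodExcept are a function local to its definition; unification recovers it.
  exceptFactors : ∀ n (i : Fin n) (f : Fin n → Carrier) →
                  Σ (Fin n → Carrier) λ g → prodExcept n i f ≡ prodFin n g
  exceptFactors n i f = _ , ≡.refl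

  exceptFactor : ∀ n (i : Fin n) (f : Fin n → Carrier) → Fin n → Carrier
  exceptFactor n i f = proj₁ (exceptFactors n i f)

  exceptFactor-≢ : ∀ n (i : Fin n) f {m} → m ≢ i → exceptFactor n i f m ≈ f m
  exceptFactor-≢ n i f {m} m≢i with m ≟ i
  ... | yes m≡i = contradiction m≡i m≢i
  ... | no  _   = refl

  prodExcept-≉0 : ∀ n (i : Fin n) f → (∀ m → m ≢ i → ¬ f m ≈ 0#) → ¬ prodExcept n i f ≈ 0#
  prodExcept-≉0 n i f f≉0 = prodFin-≉0 n (exceptFactor n i f) factor≉0
    where
    factor≉0 : ∀ m → ¬ exceptFactor n i f m ≈ 0#
    factor≉0 m with m ≟ i
    ... | yes _   = 1≉0
    ... | no  m≢i = f≉0 m m≢i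

  prodExcept-≈0 : ∀ n (i : Fin n) f {m} → m ≢ i → f m ≈ 0# → prodExcept n i f ≈ 0#
  prodExcept-≈0 n i f {m} m≢i fm≈0 =
    prodFin-≈0 n (exceptFactor n i f) m (trans (exceptFactor-≢ n i f m≢i) fm≈0)

  prodList : ∀ {a} {A : Set a} → (A → Carrier) → List A → Carrier
  prodList f = foldr (λ a p → f a * p) 1#

  prodFin-tabulate : ∀ {A : Set} n (f : A → Carrier) (g : Fin n → A) →
                     prodFin n (f ∘ g) ≡ prodList f (tabulate g)
  prodFin-tabulate zero    f g = ≡.refl
  prodFin-tabulate (suc n) f g = ≡.cong (f (g Fin.zero) *_) (prodFin-tabulate n f (g ∘ Fin.suc))

  prodList-exceptFactor : ∀ n (i : Fin n) f (ms : List (Fin n)) →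
                          prodList (exceptFactor n i f) ms ≈ prodList f (filter (λ m → ¬? (m ≟ i)) ms)
  prodList-exceptFactor n i f []       = refl
  prodList-exceptFactor n i f (m ∷ ms) with m ≟ i
  ... | yes _ = trans (*-identityˡ _) (prodList-exceptFactor n i f ms)
  ... | no  _ = *-congˡ (prodList-exceptFactor n i f ms)

  prodExcept-others : ∀ n (i : Fin n) f → prodExcept n i f ≈ prodList f (others n i)
  prodExcept-others n i f =
    trans (reflexive (prodFin-tabulate n (exceptFactor n i f) id)) (prodList-exceptFactor n i f (allFin n))

  length-others : ∀ s (i : Fin (suc s)) → length (others (suc s) i) ≡ s
  length-others s       Fin.zero    = all-kept id
    where
    all-kept : ∀ {k} (g : Fin k → Fin s) →
               length (filter (λ m → ¬? (m ≟ Fin.zero)) (tabulate (Fin.suc ∘ g))) ≡ k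
    all-kept {zero}  g = ≡.refl
    all-kept {suc k} g = ≡.cong suc (all-kept (g ∘ Fin.suc))
  length-others (suc s) (Fin.suc i) = ≡.cong suc (≡.trans (shift id) (length-others s i))
    where
    shift : ∀ {k} (g : Fin k → Fin (suc s)) →
            length (filter (λ m → ¬? (m ≟ Fin.suc i)) (tabulate (Fin.suc ∘ g))) ≡
            length (filter (λ m → ¬? (m ≟ i)) (tabulate g))
    shift {zero}  g = ≡.refl
    shift {suc k} g with g Fin.zero ≟ i
    ... | yes _ = shift (g ∘ Fin.suc)
    ... | no  _ = ≡.cong suc (shift (g ∘ Fin.suc))

  prodList-cong : ∀ {a} {A : Set a} {f g : A → Carrier} → (∀ a → f a ≈ g a) →
                  ∀ as → prodList f as ≈ prodList g as
  prodList-cong f≈g []       = refl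
  prodList-cong f≈g (a ∷ as) = *-cong (f≈g a) (prodList-cong f≈g as)

  prodList-scale : ∀ {a} {A : Set a} c (f : A → Carrier) as →
                   prodList (λ a → c * f a) as ≈ c ^ length as * prodList f as
  prodList-scale c f []       = sym (*-identityˡ 1#)
  prodList-scale c f (a ∷ as) = trans (*-congˡ (prodList-scale c f as)) (*-interchange c (f a) (c ^ length as) _)

  prodExcept-flip : ∀ s (i : Fin (suc s)) (p : Fin (suc s) → Carrier) →
                    prodExcept (suc s) i (λ m → p i - p m) ≈ (- 1#) ^ s * prodExcept (suc s) i (λ m → p m - p i)
  prodExcept-flip s i p = begin
    prodExcept (suc s) i (λ m → p i - p m)
      ≈⟨ prodExcept-others (suc s) i (λ m → p i - p m) ⟩
    prodList (λ m → p i - p m) ms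
      ≈⟨ prodList-cong flip ms ⟩
    prodList (λ m → - 1# * (p m - p i)) ms
      ≈⟨ prodList-scale (- 1#) (λ m → p m - p i) ms ⟩
    (- 1#) ^ length ms * prodList (λ m → p m - p i) ms
      ≡⟨ ≡.cong (λ e → (- 1#) ^ e * prodList (λ m → p m - p i) ms) (length-others s i) ⟩
    (- 1#) ^ s * prodList (λ m → p m - p i) ms
      ≈⟨ *-congˡ (prodExcept-others (suc s) i (λ m → p m - p i)) ⟨
    (- 1#) ^ s * prodExcept (suc s) i (λ m → p m - p i) ∎
    where
    ms = others (suc s) i
    flip : ∀ m → p i - p m ≈ - 1# * (p m - p i)
    flip m = trans (sym (⁻¹-anti-homo‿- (p m) (p i))) (sym (-1*x≈-x _))

  prodList-mapL : ∀ {A : Set} (f : Carrier → Carrier) (g : A → Carrier) as →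
                  prodList f (mapL g as) ≡ prodList (f ∘ g) as
  prodList-mapL f g []       = ≡.refl
  prodList-mapL f g (a ∷ as) = ≡.cong (f (g a) *_) (prodList-mapL f g as)

  length-mapL : ∀ {A : Set} (g : A → Carrier) as → length (mapL g as) ≡ length as
  length-mapL g []       = ≡.refl
  length-mapL g (a ∷ as) = ≡.cong suc (length-mapL g as)

module Polynomials {c ℓ : Level} (K : Field c ℓ) where
  open Field K
  open FieldOps K
  open FieldProperties K using (x-y≈0⇒x≈y; x*y≈0⇒y≈0)
  open Products K using (prodList)
  open Sums commutativeRing using (∑-reverse; ∑∑-assoc; δ; ∑-δ)
  open import Algebra.Properties.Semiring.Sum semiring
  open import Algebra.Properties.CommutativeSemiring.Exp commutativeSemiring
  open import Algebra.Properties.Group +-group using (//-rightDividesˡ; identityˡ-unique)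
  open import Algebra.Properties.CommutativeSemigroup *-commutativeSemigroup
    using () renaming (x∙yz≈y∙xz to x*yz≈y*xz)
  open import Algebra.Properties.CommutativeSemigroup +-commutativeSemigroup
    using () renaming (x∙yz≈y∙xz to x+yz≈y+xz)
  open import Relation.Binary.Reasoning.Setoid setoid

  private
    almostCommutativeRing : AlmostCommutativeRing c ℓ
    almostCommutativeRing = fromCommutativeRing commutativeRing (λ _ → nothing)
  open import Tactic.RingSolver.NonReflective almostCommutativeRing using (solve; _⊜_; _⊕_; _⊗_)

  eval : ∀ {n} → (Fin n → Carrier) → Carrier → Carrier
  eval {n} cs z = ∑[ m < n ] (cs m * z ^ toℕ m)

  eval-horner : ∀ {n} (cs : Fin (suc n) → Carrier) z → eval cs z ≈ head cs + z * eval (tail cs) z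
  eval-horner {n} cs z = +-cong (*-identityʳ (head cs)) (begin
    ∑[ m < n ] (tail cs m * (z * z ^ toℕ m))
      ≈⟨ sum-cong-≋ {n} (λ m → x*yz≈y*xz (tail cs m) z (z ^ toℕ m)) ⟩
    ∑[ m < n ] (z * (tail cs m * z ^ toℕ m))
      ≈⟨ *-distribˡ-sum {n} z _ ⟨
    z * eval (tail cs) z ∎)

  -- Coefficients of the quotient of cs by z - a (synthetic division).
  quotient : ∀ {n} → Carrier → (Fin (suc n) → Carrier) → Fin n → Carrier
  quotient a cs Fin.zero    = eval (tail cs) a
  quotient a cs (Fin.suc i) = quotient a (tail cs) i

  eval-divide : ∀ {n} a (cs : Fin (suc n) → Carrier) z →
                eval cs z ≈ (z - a) * eval (quotient a cs) z + eval cs a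
  eval-divide {zero}  a cs z = sym (trans (+-congʳ (zeroʳ (z - a))) (+-identityˡ (eval cs a)))
  eval-divide {suc n} a cs z = begin
    eval cs z
      ≈⟨ eval-horner cs z ⟩
    head cs + z * eval (tail cs) z
      ≈⟨ +-congˡ (*-congˡ (eval-divide a (tail cs) z)) ⟩
    head cs + z * ((z - a) * Q + E)
      ≈⟨ +-congˡ (*-congʳ z≈[z-a]+a) ⟩
    head cs + ((z - a) + a) * ((z - a) * Q + E)
      ≈⟨ regroup (head cs) (z - a) a Q E ⟩
    (z - a) * (E + ((z - a) + a) * Q) + (head cs + a * E)
      ≈⟨ +-congʳ (*-congˡ (+-congˡ (*-congʳ z≈[z-a]+a))) ⟨
    (z - a) * (E + z * Q) + (head cs + a * E)
      ≈⟨ +-cong (*-congˡ (eval-horner (quotient a cs) z)) (eval-horner cs a) ⟨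
    (z - a) * eval (quotient a cs) z + eval cs a ∎
    where
    Q = eval (quotient a (tail cs)) z
    E = eval (tail cs) a
    z≈[z-a]+a : z ≈ (z - a) + a
    z≈[z-a]+a = sym (//-rightDividesˡ a z)
    -- z is written as (z - a) + a because the solver, lacking a zero test, cannot cancel - a + a.
    regroup : ∀ c w a Q E → c + (w + a) * (w * Q + E) ≈ w * (E + (w + a) * Q) + (c + a * E)
    regroup = solve 5 (λ c w a Q E →
      (c ⊕ (w ⊕ a) ⊗ (w ⊗ Q ⊕ E)) ⊜ (w ⊗ (E ⊕ (w ⊕ a) ⊗ Q) ⊕ (c ⊕ a ⊗ E))) refl

  quotient≈0⇒≈0 : ∀ {n} a (cs : Fin (suc n) → Carrier) → (∀ m → quotient a cs m ≈ 0#) →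
                  eval cs a ≈ 0# → ∀ m → cs m ≈ 0#
  quotient≈0⇒≈0 {n} a cs q≈0 cs[a]≈0 Fin.zero = begin
    head cs                         ≈⟨ +-identityʳ (head cs) ⟨
    head cs + 0#                    ≈⟨ +-congˡ (trans (*-congˡ (tail[a]≈0 n q≈0)) (zeroʳ a)) ⟨
    head cs + a * eval (tail cs) a  ≈⟨ eval-horner cs a ⟨
    eval cs a                       ≈⟨ cs[a]≈0 ⟩
    0#                              ∎
    where
    tail[a]≈0 : ∀ n {cs : Fin (suc n) → Carrier} → (∀ m → quotient a cs m ≈ 0#) → eval (tail cs) a ≈ 0#
    tail[a]≈0 zero    _   = refl
    tail[a]≈0 (suc n) q≈0 = q≈0 Fin.zero
  quotient≈0⇒≈0 {suc n} a cs q≈0 _ (Fin.suc m) =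
    quotient≈0⇒≈0 a (tail cs) (q≈0 ∘ Fin.suc) (q≈0 Fin.zero) m

  eval-vanishing : ∀ {n} (p : Fin n → Carrier) → (∀ i j → i ≢ j → ¬ p i ≈ p j) →
                   (cs : Fin n → Carrier) → (∀ j → eval cs (p j) ≈ 0#) → ∀ m → cs m ≈ 0#
  eval-vanishing {suc n} p p-distinct cs cs[p]≈0 =
    quotient≈0⇒≈0 a cs (eval-vanishing (p ∘ Fin.suc) p∘suc-distinct (quotient a cs) q[p]≈0)
                       (cs[p]≈0 Fin.zero)
    where
    a = p Fin.zero
    p∘suc-distinct : ∀ i j → i ≢ j → ¬ p (Fin.suc i) ≈ p (Fin.suc j)
    p∘suc-distinct i j i≢j = p-distinct (Fin.suc i) (Fin.suc j) (i≢j ∘ suc-injective)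
    q[p]≈0 : ∀ j → eval (quotient a cs) (p (Fin.suc j)) ≈ 0#
    q[p]≈0 j = x*y≈0⇒y≈0 (p-distinct (Fin.suc j) Fin.zero (λ ()) ∘ x-y≈0⇒x≈y) (begin
      (z - a) * eval (quotient a cs) z                     ≈⟨ +-identityʳ _ ⟨
      (z - a) * eval (quotient a cs) z + 0#                ≈⟨ +-congˡ (cs[p]≈0 Fin.zero) ⟨
      (z - a) * eval (quotient a cs) z + eval cs a         ≈⟨ eval-divide a cs z ⟨
      eval cs z                                            ≈⟨ cs[p]≈0 (Fin.suc j) ⟩
      0#                                                   ∎)
      where z = p (Fin.suc j)

  eval-injective : ∀ {n} (p : Fin n → Carrier) → (∀ i j → i ≢ j → ¬ p i ≈ p j) →
                   (cs ds : Fin n → Carrier) → (∀ j → eval cs (p j) ≈ eval ds (p j)) → ∀ m → cs m ≈ ds m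
  eval-injective {n} p p-distinct cs ds agree m =
    x-y≈0⇒x≈y (eval-vanishing p p-distinct (λ m → cs m - ds m) difference-vanishes m)
    where
    eval-difference : ∀ z → eval (λ m → cs m - ds m) z + eval ds z ≈ eval cs z
    eval-difference z = begin
      eval (λ m → cs m - ds m) z + eval ds z
        ≈⟨ ∑-distrib-+ {n} _ _ ⟨
      ∑[ m < n ] ((cs m - ds m) * z ^ toℕ m + ds m * z ^ toℕ m)
        ≈⟨ sum-cong-≋ {n} (λ m → distribʳ _ _ _) ⟨
      ∑[ m < n ] ((cs m - ds m + ds m) * z ^ toℕ m)
        ≈⟨ sum-cong-≋ {n} (λ m → *-congʳ (//-rightDividesˡ (ds m) (cs m))) ⟩
      eval cs z ∎
    difference-vanishes : ∀ j → eval (λ m → cs m - ds m) (p j) ≈ 0#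
    difference-vanishes j = identityˡ-unique _ _ (trans (eval-difference (p j)) (agree j))

  vandermonde-inverse : ∀ {n} (p : Fin n → Carrier) → (∀ i j → i ≢ j → ¬ p i ≈ p j) →
                        (C : Fin n → Fin n → Carrier) → (∀ i j → eval (C i) (p j) ≈ δ i j) →
                        ∀ k m → ∑[ i < n ] (p i ^ toℕ k * C i m) ≈ δ m k
  vandermonde-inverse {n} p p-distinct C left-inverse k =
    eval-injective p p-distinct (λ m → ∑[ i < n ] (p i ^ toℕ k * C i m)) (λ m → δ m k) agree
    where
    agree : ∀ j → eval (λ m → ∑[ i < n ] (p i ^ toℕ k * C i m)) (p j) ≈ eval (λ m → δ m k) (p j)
    agree j = begin
      eval (λ m → ∑[ i < n ] (p i ^ toℕ k * C i m)) (p j)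
        ≈⟨ ∑∑-assoc (λ i → p i ^ toℕ k) C (λ m → p j ^ toℕ m) ⟩
      ∑[ i < n ] (p i ^ toℕ k * eval (C i) (p j))
        ≈⟨ sum-cong-≋ {n} (λ i → trans (*-congˡ (left-inverse i j)) (*-comm _ _)) ⟩
      ∑[ i < n ] (δ i j * p i ^ toℕ k)
        ≈⟨ ∑-δ (λ i → p i ^ toℕ k) j ⟩
      p j ^ toℕ k
        ≈⟨ ∑-δ (λ m → p j ^ toℕ m) k ⟨
      eval (λ m → δ m k) (p j) ∎

  eval-opposite : ∀ {n} (cs : Fin n → Carrier) z →
                  eval (λ m → cs (opposite m)) z ≈ ∑[ t < n ] (cs t * z ^ (n ∸ suc (toℕ t)))
  eval-opposite {n} cs z = begin
    eval (λ m → cs (opposite m)) z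
      ≈⟨ ∑-reverse (λ m → cs (opposite m) * z ^ toℕ m) ⟩
    ∑[ t < n ] (cs (opposite (opposite t)) * z ^ toℕ (opposite t))
      ≡⟨ sum-cong-≗ {n} (λ t → ≡.cong₂ (λ u e → cs u * z ^ e) (opposite-involutive t) (opposite-prop t)) ⟩
    ∑[ t < n ] (cs t * z ^ (n ∸ suc (toℕ t))) ∎

  descPoly : ℕ → (ℕ → Carrier) → Carrier → Carrier
  descPoly s c w = ∑[ t < suc s ] (c (toℕ t) * w ^ (s ∸ toℕ t))

  descPoly-linear : ∀ s a (c d : ℕ → Carrier) w →
                    descPoly s (λ t → a * c t + d t) w ≈ a * descPoly s c w + descPoly s d w
  descPoly-linear s a c d w = begin
    ∑[ t < suc s ] ((a * c (toℕ t) + d (toℕ t)) * W t)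
      ≈⟨ sum-cong-≋ {suc s} (λ t → distribʳ (W t) (a * c (toℕ t)) (d (toℕ t))) ⟩
    ∑[ t < suc s ] (a * c (toℕ t) * W t + d (toℕ t) * W t)
      ≈⟨ ∑-distrib-+ (λ t → a * c (toℕ t) * W t) (λ t → d (toℕ t) * W t) ⟩
    ∑[ t < suc s ] (a * c (toℕ t) * W t) + descPoly s d w
      ≈⟨ +-congʳ (sum-cong-≋ {suc s} (λ t → *-assoc a (c (toℕ t)) (W t))) ⟩
    ∑[ t < suc s ] (a * (c (toℕ t) * W t)) + descPoly s d w
      ≈⟨ +-congʳ (*-distribˡ-sum a (λ t → c (toℕ t) * W t)) ⟨
    a * descPoly s c w + descPoly s d w ∎
    where
    W : Fin (suc s) → Carrier
    W t = w ^ (s ∸ toℕ t)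

  *-descPoly : ∀ s (c : ℕ → Carrier) w → c (suc s) ≈ 0# → w * descPoly s c w ≈ descPoly (suc s) c w
  *-descPoly zero c w c1≈0 = begin
    w * (c 0 * 1# + 0#)
      ≈⟨ *-congˡ (+-identityʳ _) ⟩
    w * (c 0 * 1#)
      ≈⟨ x*yz≈y*xz w (c 0) 1# ⟩
    c 0 * (w * 1#)
      ≈⟨ +-identityʳ _ ⟨
    c 0 * (w * 1#) + 0#
      ≈⟨ +-congˡ (trans (+-identityʳ _) (trans (*-congʳ c1≈0) (zeroˡ 1#))) ⟨
    c 0 * (w * 1#) + (c 1 * 1# + 0#) ∎
  *-descPoly (suc s) c w c[2+s]≈0 = begin
    w * (c 0 * w ^ suc s + descPoly s (c ∘ suc) w)
      ≈⟨ distribˡ w _ _ ⟩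
    w * (c 0 * w ^ suc s) + w * descPoly s (c ∘ suc) w
      ≈⟨ +-cong (x*yz≈y*xz w (c 0) _) (*-descPoly s (c ∘ suc) w c[2+s]≈0) ⟩
    c 0 * w ^ suc (suc s) + descPoly (suc s) (c ∘ suc) w ∎

  esym-length : ∀ k (bs : List Carrier) → length bs < k → esym k bs ≈ 0#
  esym-length (suc k) []       _               = refl
  esym-length (suc k) (b ∷ bs) (s≤s |bs|<k) = begin
    b * esym k bs + esym (suc k) bs
      ≈⟨ +-cong (*-congˡ (esym-length k bs |bs|<k)) (esym-length (suc k) bs (m<n⇒m<1+n |bs|<k)) ⟩
    b * 0# + 0#
      ≈⟨ +-identityʳ _ ⟩
    b * 0#
      ≈⟨ zeroʳ b ⟩
    0# ∎

  vieta : ∀ w (bs : List Carrier) → prodList (λ b → b + w) bs ≈ descPoly (length bs) (λ t → esym t bs) w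
  vieta w []       = sym (trans (+-identityʳ _) (*-identityˡ 1#))
  vieta w (a ∷ bs) = begin
    (a + w) * prodList (λ b → b + w) bs
      ≈⟨ *-congˡ (vieta w bs) ⟩
    (a + w) * D
      ≈⟨ distribʳ D a w ⟩
    a * D + w * D
      ≈⟨ +-congˡ (*-descPoly s e w (esym-length (suc s) bs (n<1+n s))) ⟩
    a * D + (1# * w ^ suc s + descPoly s (e ∘ suc) w)
      ≈⟨ x+yz≈y+xz _ _ _ ⟩
    1# * w ^ suc s + (a * D + descPoly s (e ∘ suc) w)
      ≈⟨ +-congˡ (descPoly-linear s a e (e ∘ suc) w) ⟨
    1# * w ^ suc s + descPoly s (λ t → a * e t + e (suc t)) w ∎
    where
    s = length bs
    e : ℕ → Carrier
    e t = esym t bs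
    D = descPoly s e w

module LagrangeInterpolation {c ℓ : Level} (K : Field c ℓ) where
  open Field K
  open FieldOps K
  open FieldProperties K
  open Products K
  open Polynomials K
  open Sums commutativeRing using (∑-reverse; ∑∑-assoc; δ; ∑-δ)
  open LinearRecurrences commutativeRing
  open import Algebra.Properties.Semiring.Sum semiring
  open import Algebra.Properties.CommutativeSemiring.Exp commutativeSemiring
  open import Relation.Binary.Reasoning.Setoid setoid

  pow≡^ : ∀ x n → pow x n ≡ x ^ n
  pow≡^ x zero    = ≡.refl
  pow≡^ x (suc n) = ≡.cong (x *_) (pow≡^ x n)

  sumFin≡∑ : ∀ n f → sumFin n f ≡ ∑[ i < n ] f i
  sumFin≡∑ zero    f = ≡.refl
  sumFin≡∑ (suc n) f = ≡.cong (f Fin.zero +_) (sumFin≡∑ n (f ∘ Fin.suc))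

  module LagrangeBasis (s : ℕ) (lam : Fin (suc s) → Carrier)
                       (distinct : ∀ i j → i ≢ j → ¬ lam i ≈ lam j) where

    otherRoots : Fin (suc s) → List Carrier
    otherRoots i = mapL lam (others (suc s) i)

    denominator : Fin (suc s) → Carrier
    denominator i = prodExcept (suc s) i (λ m → lam m - lam i)

    denominator-≉0 : ∀ i → ¬ denominator i ≈ 0#
    denominator-≉0 i = prodExcept-≉0 (suc s) i _ (λ m m≢i → distinct m i m≢i ∘ x-y≈0⇒x≈y)

    denominator*σ : ∀ i t →
                    denominator i * σ (suc s) lam i t ≈ (- 1#) ^ (s ∸ toℕ t) * esym (toℕ t) (otherRoots i)
    denominator*σ i Fin.zero = begin
      denominator i * prodExcept (suc s) i (λ m → lam i - lam m) ⁻¹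
        ≈⟨ *-congˡ (⁻¹-sign s (denominator-≉0 i) (prodExcept-flip s i lam)) ⟩
      denominator i * ((- 1#) ^ s * denominator i ⁻¹)
        ≈⟨ x*[y*x⁻¹]≈y ((- 1#) ^ s) (denominator-≉0 i) ⟩
      (- 1#) ^ s
        ≈⟨ *-identityʳ ((- 1#) ^ s) ⟨
      (- 1#) ^ s * 1# ∎
    denominator*σ i (Fin.suc t) = begin
      denominator i * (pow (- 1#) k * (e * denominator i ⁻¹))
        ≈⟨ *-congˡ (*-assoc (pow (- 1#) k) e (denominator i ⁻¹)) ⟨
      denominator i * ((pow (- 1#) k * e) * denominator i ⁻¹)
        ≈⟨ x*[y*x⁻¹]≈y (pow (- 1#) k * e) (denominator-≉0 i) ⟩
      pow (- 1#) k * e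
        ≡⟨ ≡.cong (_* e) (pow≡^ (- 1#) k) ⟩
      (- 1#) ^ k * e ∎
      where
      k = s ∸ suc (toℕ t)
      e = esym (suc (toℕ t)) (otherRoots i)

    σ-polynomial : ∀ i z → denominator i * ∑[ t < suc s ] (σ (suc s) lam i t * z ^ (s ∸ toℕ t)) ≈
                           prodExcept (suc s) i (λ m → lam m - z)
    σ-polynomial i z = begin
      denominator i * ∑[ t < suc s ] (σ (suc s) lam i t * z ^ (s ∸ toℕ t))
        ≈⟨ *-distribˡ-sum (denominator i) (λ t → σ (suc s) lam i t * z ^ (s ∸ toℕ t)) ⟩
      ∑[ t < suc s ] (denominator i * (σ (suc s) lam i t * z ^ (s ∸ toℕ t)))
        ≈⟨ sum-cong-≋ {suc s} term ⟩
      descPoly s e (- z)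
        ≡⟨ ≡.cong (λ n → descPoly n e (- z)) length-otherRoots ⟨
      descPoly (length (otherRoots i)) e (- z)
        ≈⟨ vieta (- z) (otherRoots i) ⟨
      prodList (λ b → b - z) (otherRoots i)
        ≡⟨ prodList-mapL (λ b → b - z) lam (others (suc s) i) ⟩
      prodList (λ m → lam m - z) (others (suc s) i)
        ≈⟨ prodExcept-others (suc s) i (λ m → lam m - z) ⟨
      prodExcept (suc s) i (λ m → lam m - z) ∎
      where
      e : ℕ → Carrier
      e t = esym t (otherRoots i)
      term : ∀ t → denominator i * (σ (suc s) lam i t * z ^ (s ∸ toℕ t)) ≈
                   e (toℕ t) * (- z) ^ (s ∸ toℕ t)
      term t = begin
        denominator i * (σ (suc s) lam i t * z ^ k)   ≈⟨ *-assoc _ _ _ ⟨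
        (denominator i * σ (suc s) lam i t) * z ^ k   ≈⟨ *-congʳ (denominator*σ i t) ⟩
        ((- 1#) ^ k * e (toℕ t)) * z ^ k              ≈⟨ *-congʳ (*-comm _ _) ⟩
        (e (toℕ t) * (- 1#) ^ k) * z ^ k              ≈⟨ *-assoc _ _ _ ⟩
        e (toℕ t) * ((- 1#) ^ k * z ^ k)              ≈⟨ *-congˡ ([-x]^n≈[-1]^n*x^n z k) ⟨
        e (toℕ t) * (- z) ^ k                         ∎
        where k = s ∸ toℕ t
      length-otherRoots : length (otherRoots i) ≡ s
      length-otherRoots = ≡.trans (length-mapL lam (others (suc s) i)) (length-others s i)

    σ-lagrange : ∀ i j → eval (λ m → σ (suc s) lam i (opposite m)) (lam j) ≈ δ i j
    σ-lagrange i j = trans (eval-opposite (σ (suc s) lam i) (lam j)) (at-node i j)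
      where
      at-node : ∀ i j → ∑[ t < suc s ] (σ (suc s) lam i t * lam j ^ (s ∸ toℕ t)) ≈ δ i j
      at-node i j with i ≟ j
      ... | yes ≡.refl = *-cancelˡ-≉0 (denominator-≉0 i)
                           (trans (σ-polynomial i (lam i)) (sym (*-identityʳ (denominator i))))
      ... | no  i≢j    = x*y≈0⇒y≈0 (denominator-≉0 i)
                           (trans (σ-polynomial i (lam j))
                                  (prodExcept-≈0 (suc s) i _ (i≢j ∘ ≡.sym) (-‿inverseʳ (lam j))))

  coefficient : ∀ s → (Fin (suc s) → Carrier) → (Fin (suc s) → Carrier) → Fin (suc s) → Carrier
  coefficient s lam l i = ∑[ j < suc s ] (σ (suc s) lam i j * l (opposite j))

  closed-form-initial : ∀ s (l lam : Fin (suc s) → Carrier) → (∀ i j → i ≢ j → ¬ lam i ≈ lam j) → ∀ k →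
                        ∑[ i < suc s ] (lam i ^ toℕ k * coefficient s lam l i) ≈ l k
  closed-form-initial s l lam distinct k = begin
    ∑[ i < suc s ] (lam i ^ toℕ k * coefficient s lam l i)
      ≈⟨ sum-cong-≋ {suc s} (λ i → *-congˡ {lam i ^ toℕ k} (coefficient-reversed i)) ⟩
    ∑[ i < suc s ] (lam i ^ toℕ k * ∑[ m < suc s ] (C i m * l m))
      ≈⟨ ∑∑-assoc (λ i → lam i ^ toℕ k) C l ⟨
    ∑[ m < suc s ] (∑[ i < suc s ] (lam i ^ toℕ k * C i m) * l m)
      ≈⟨ sum-cong-≋ {suc s} (λ m → *-congʳ {l m} (right-inverse m)) ⟩
    ∑[ m < suc s ] (δ m k * l m)
      ≈⟨ ∑-δ l k ⟩
    l k ∎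
    where
    open LagrangeBasis s lam distinct
    C : Fin (suc s) → Fin (suc s) → Carrier
    C i m = σ (suc s) lam i (opposite m)
    coefficient-reversed : ∀ i → coefficient s lam l i ≈ ∑[ m < suc s ] (C i m * l m)
    coefficient-reversed i = trans (∑-reverse (λ j → σ (suc s) lam i j * l (opposite j)))
      (reflexive (sum-cong-≗ {suc s} (λ m → ≡.cong (λ u → C i m * l u) (opposite-involutive m))))
    right-inverse : ∀ m → ∑[ i < suc s ] (lam i ^ toℕ k * C i m) ≈ δ m k
    right-inverse m = vandermonde-inverse lam distinct C σ-lagrange k m

  closed-form : ∀ s (x l lam : Fin (suc s) → Carrier) {F : ℕ → Carrier} → SolvesRecurrence x F →
                (∀ k → F (toℕ k) ≈ l k) → (∀ i j → i ≢ j → ¬ lam i ≈ lam j) →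
                (∀ i → lam i ^ suc s ≈ ∑[ k < suc s ] (x k * lam i ^ (suc s ∸ suc (toℕ k)))) →
                ∀ n → F n ≈ ∑[ i < suc s ] (lam i ^ n * coefficient s lam l i)
  closed-form s x l lam F-rec F-initial distinct root =
    recurrence-unique x F-rec
      (combination-solves x (λ i → lam i ^_) (coefficient s lam l)
                          (λ i → root-powers-solve x (lam i) (root i)))
      (λ k → trans (F-initial k) (sym (closed-form-initial s l lam distinct k)))

theorem2p3 : {c ℓ : Level} (K : Field c ℓ) →
    let open Field K
        open FieldOps K
    in
    (r : ℕ) → 2 ≤ r →
    (x : Fin r → Carrier) → (l : Fin r → Carrier) →
    (F : ℕ → Carrier) →
    (∀ (k : Fin r) → F (toℕ k) ≈ l k) →
    (∀ (n : ℕ) → r ≤ n → F n ≈ sumFin r (λ k → x k * F (n ∸ suc (toℕ k)))) →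
    (lam : Fin r → Carrier) →
    (∀ (i j : Fin r) → i ≢ j → ¬ (lam i ≈ lam j)) →
    (∀ (i : Fin r) → pow (lam i) r - sumFin r (λ k → x k * pow (lam i) (r ∸ suc (toℕ k))) ≈ 0#) →
    ∀ (n : ℕ) → F n ≈ sumFin r (λ i → pow (lam i) n * sumFin r (λ j → σ r lam i j * l (opposite j)))
theorem2p3 K (suc s) _ x l F F-initial F-rec lam distinct root-equation n =
  trans (closed-form s x l lam F-rec′ F-initial distinct root n) (reflexive (≡.sym closed-form≡))
  where
  open Field K
  open FieldOps K
  open FieldProperties K using (x-y≈0⇒x≈y)
  open LagrangeInterpolation K
  open LinearRecurrences commutativeRing using (SolvesRecurrence)
  open import Algebra.Properties.Semiring.Sum semiring using (sum-syntax; sum-cong-≗)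
  open import Algebra.Properties.Semiring.Exp semiring using (_^_)

  F-rec′ : SolvesRecurrence x F
  F-rec′ n r≤n = trans (F-rec n r≤n) (reflexive (sumFin≡∑ (suc s) (λ k → x k * F (n ∸ suc (toℕ k)))))

  root : ∀ i → lam i ^ suc s ≈ ∑[ k < suc s ] (x k * lam i ^ (suc s ∸ suc (toℕ k)))
  root i = trans (reflexive (≡.sym (pow≡^ (lam i) (suc s))))
                 (trans (x-y≈0⇒x≈y (root-equation i)) (reflexive powers≡))
    where
    e : Fin (suc s) → ℕ
    e k = suc s ∸ suc (toℕ k)
    powers≡ : sumFin (suc s) (λ k → x k * pow (lam i) (e k)) ≡ ∑[ k < suc s ] (x k * lam i ^ e k)
    powers≡ = ≡.trans (sumFin≡∑ (suc s) (λ k → x k * pow (lam i) (e k)))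
                      (sum-cong-≗ {suc s} (λ k → ≡.cong (x k *_) (pow≡^ (lam i) (e k))))

  closed-form≡ : sumFin (suc s) (λ i → pow (lam i) n * sumFin (suc s) (λ j → σ (suc s) lam i j * l (opposite j))) ≡
                 ∑[ i < suc s ] (lam i ^ n * coefficient s lam l i)
  closed-form≡ =
    ≡.trans (sumFin≡∑ (suc s) (λ i → pow (lam i) n * sumFin (suc s) (λ j → σ (suc s) lam i j * l (opposite j))))
            (sum-cong-≗ {suc s} (λ i → ≡.cong₂ _*_ (pow≡^ (lam i) n) (coefficient≡ i)))
    where
    coefficient≡ : ∀ i → sumFin (suc s) (λ j → σ (suc s) lam i j * l (opposite j)) ≡ coefficient s lam l i
    coefficient≡ i = sumFin≡∑ (suc s) (λ j → σ (suc s) lam i j * l (opposite j))
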